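{- Let $q$ be a prime power, $s\ge 1$, $m\ge 1$, and let $G$ be a generator matrix of the $q$-ary Simplex code $\mathcal{S}_q(s)$ of length $n=(q^s-1)/(q-1)$ whose columns are one representative of each point of $\mathrm{PG}(s-1,q)$; let $P_i$ be the point given by the $i$-th column. If $\mathbf{c}$ is a word of weight $(q^s-q^{s-m})/(q-1)$ in the extension code $\mathcal{S}_q(s)\otimes\mathbb{F}_{q^m}$, then $\{P_i: i\in[n]\setminus\mathrm{supp}(\mathbf{c})\}$ is the set of all points of some projective subspace of $\mathrm{PG}(s-1,q)$ of codimension $m$.
   Context: The $q$-ary Simplex code $\mathcal{S}_q(s)$ is the linear $[(q^s-1)/(q-1),s]$ code over $\mathbb{F}_q$ whose generator matrix has as columns all nonzero vectors of $\mathbb{F}_q^s$ up to scalar multiplication. The extension code $C\otimes\mathbb{F}_{q^m}$ of a code $C$ over $\mathbb{F}_q$ is the $\mathbb{F}_{q^m}$-linear span of $C$ in $\mathbb{F}_{q^m}^n$ (it has the same generator matrix). $\mathrm{supp}(\mathbf{c})$ is the set of nonzero coordinates of $\mathbf{c}$ and $[n]=\{1,\dots,n\}$. -}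

module Defs where

open import Level using (0ℓ)
open import Data.Nat using (ℕ; zero; suc)
open import Data.Fin using (Fin)
import Data.Fin as Fin
import Data.Fin.Properties as FinP
open import Data.Product using (Σ; ∃; _×_; _,_)
open import Relation.Nullary using (¬_; Dec; yes; no)
open import Relation.Nullary.Decidable using (map′)
open import Relation.Binary.PropositionalEquality using (_≡_; _≢_; cong; sym; trans)
open import Algebra.Structures using (IsCommutativeRing)
open import Algebra.Bundles using (CommutativeRing; RawRing)
open import Function.Bundles using (_↔_; Inverse)
open import Algebra.Morphism.Structures using (module RingMorphisms)

-- A finite field with exactly q elements (equality is propositional).
-- Every finite field has prime-power order, so "q is a prime power"
-- is exactly the condition that such a field exists.

record FiniteField (q : ℕ) : Set₁ where
  infixl 7 _*_
  infixl 6 _+_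
  field
    Carrier : Set
    _+_ _*_ : Carrier → Carrier → Carrier
    -_      : Carrier → Carrier
    0# 1#   : Carrier
    isCommutativeRing : IsCommutativeRing _≡_ _+_ _*_ -_ 0# 1#
    0≢1     : 0# ≢ 1#
    inverse : ∀ x → x ≢ 0# → ∃ λ y → x * y ≡ 1#
    card    : Carrier ↔ Fin q

  commutativeRing : CommutativeRing 0ℓ 0ℓ
  commutativeRing = record { isCommutativeRing = isCommutativeRing }

  rawRing : RawRing 0ℓ 0ℓ
  rawRing = CommutativeRing.rawRing commutativeRing

  _≟_ : (x y : Carrier) → Dec (x ≡ y)
  x ≟ y = map′ inj (cong (Inverse.to card))
               (Inverse.to card x FinP.≟ Inverse.to card y)
    where
    inj : Inverse.to card x ≡ Inverse.to card y → x ≡ y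
    inj p = trans (sym (Inverse.strictlyInverseʳ card x))
                  (trans (cong (Inverse.from card) p) (Inverse.strictlyInverseʳ card y))

  sumF : (k : ℕ) → (Fin k → Carrier) → Carrier
  sumF zero    f = 0#
  sumF (suc k) f = f Fin.zero + sumF k (λ j → f (Fin.suc j))

-- Field extension F_q ⊆ F_{q^m}, given by a ring homomorphism ι
-- (automatically injective, as F is a field).

IsFieldEmbedding : ∀ {q r} (F : FiniteField q) (K : FiniteField r) →
                   (FiniteField.Carrier F → FiniteField.Carrier K) → Set
IsFieldEmbedding F K ι =
  RingMorphisms.IsRingHomomorphism (FiniteField.rawRing F) (FiniteField.rawRing K) ι

module LinAlg {q : ℕ} (F : FiniteField q) where
  open FiniteField F

  Vector : ℕ → Set
  Vector s = Fin s → Carrier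

  zeroV : ∀ {s} → Vector s
  zeroV _ = 0#

  _·_ : ∀ {s} → Carrier → Vector s → Vector s
  (λ' · v) i = λ' * v i

  lincomb : ∀ {k s} → (Fin k → Carrier) → (Fin k → Vector s) → Vector s
  lincomb {k} a B i = sumF k (λ j → a j * B j i)

  LinearlyIndependent : ∀ {k s} → (Fin k → Vector s) → Set
  LinearlyIndependent {k} B =
    ∀ (a : Fin k → Carrier) → lincomb a B ≡ zeroV → ∀ j → a j ≡ 0#

  InSpan : ∀ {k s} → Vector s → (Fin k → Vector s) → Set
  InSpan {k} v B = ∃ λ (a : Fin k → Carrier) → v ≡ lincomb a B

  column : ∀ {s n} → (Fin s → Fin n → Carrier) → Fin n → Vector s
  column G i r = G r i

  -- G is a generator matrix of the q-ary Simplex code S_q(s) whose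
  -- columns are one representative of each point of PG(s-1,q):
  -- every column is nonzero, every nonzero vector is a scalar multiple
  -- of some column, and distinct columns span distinct points.
  IsSimplexGenerator : ∀ {s n} → (Fin s → Fin n → Carrier) → Set
  IsSimplexGenerator {s} {n} G =
      (∀ i → column G i ≢ zeroV)
    × (∀ (v : Vector s) → v ≢ zeroV → ∃ λ i → ∃ λ λ' → v ≡ λ' · column G i)
    × (∀ i j → (∃ λ λ' → column G i ≡ λ' · column G j) → i ≡ j)

module Weight {r : ℕ} (K : FiniteField r) where
  open FiniteField K

  weight : ∀ {n} → (Fin n → Carrier) → ℕ
  weight {zero}  c = 0
  weight {suc n} c with c Fin.zero ≟ 0#
  ... | yes _ = weight {n} (λ j → c (Fin.suc j))
  ... | no  _ = suc (weight {n} (λ j → c (Fin.suc j)))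

module Submission where

-- Proof.  c_i = φ(G_i) for the F_q-linear functional φ(v) = Σ_j x_j v_j on F_q^s,
-- so W = ker φ is a subspace of F_q^s and c_i = 0 iff G_i ∈ W.  Every nonzero
-- vector is a nonzero multiple of exactly one column (counting: n(q-1) = q^s - 1
-- such multiples cover the q^s - 1 nonzero vectors), hence |W| = 1 + (q-1)·z where
-- z = n - wt(c) is the number of zeros of c.  The weight condition turns this into
-- |W| = q^(s-m); a subspace with q^k elements has a basis of k vectors (grow an
-- independent family greedily and compare cardinalities of spans), and a column
-- equal to such a combination pointwise is equal to it outright.

open import Defs
open import Data.Nat as ℕ using (ℕ; zero; suc)
open import Data.Fin using (Fin)
open import Data.Product using (∃)
open import Relation.Binary.PropositionalEquality using (_≡_; _≢_)
open import Algebra.Bundles using (CommutativeRing)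

module WeightArithmetic where
  open import Data.Nat
  open import Data.Nat.Properties
  open import Data.Nat.Tactic.RingSolver using (solve-∀)
  open import Data.Product using (_×_; _,_)
  open import Relation.Binary.PropositionalEquality

  zeroCount-equation : ∀ q′ s m n w z → n * q′ ≡ suc q′ ^ s ∸ 1 →
    w * q′ * suc q′ ^ m ≡ suc q′ ^ (s + m) ∸ suc q′ ^ s → w + z ≡ n →
    suc (z * q′) * suc q′ ^ m ≡ suc q′ ^ s
  zeroCount-equation q′ s m n w z length weight refl = +-cancelˡ-≡ (w * q′ * M) _ _ (begin
      w * q′ * M + suc (z * q′) * M ≡⟨ regroup w z q′ M ⟩
      ((w + z) * q′ + 1) * M       ≡⟨ cong (_* M) length-eq ⟩
      Q * M                        ≡⟨ weight-eq ⟨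
      w * q′ * M + Q               ∎)
    where
    open ≡-Reasoning
    q Q M : ℕ
    q = suc q′
    Q = q ^ s
    M = q ^ m
    instance
      M≢0 : NonZero M
      M≢0 = m^n≢0 q m
    regroup : ∀ w z q′ M → w * q′ * M + suc (z * q′) * M ≡ ((w + z) * q′ + 1) * M
    regroup = solve-∀
    length-eq : (w + z) * q′ + 1 ≡ Q
    length-eq = trans (cong (_+ 1) length) (m∸n+n≡m (m^n>0 q s))
    weight-eq : w * q′ * M + Q ≡ Q * M
    weight-eq = trans (cong (_+ Q) (trans weight (cong (_∸ Q) (^-distribˡ-+-* q s m))))
                      (m∸n+n≡m (m≤m*n Q M))

  power-quotient : ∀ q Z s m → 1 < q → suc Z * q ^ m ≡ q ^ s → m ≤ s × suc Z ≡ q ^ (s ∸ m)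
  power-quotient q Z s m 1<q eq = m≤s , *-cancelʳ-≡ (suc Z) (q ^ (s ∸ m)) (q ^ m) (begin
      suc Z * q ^ m       ≡⟨ eq ⟩
      q ^ s               ≡⟨ cong (q ^_) (m∸n+n≡m m≤s) ⟨
      q ^ (s ∸ m + m)     ≡⟨ ^-distribˡ-+-* q (s ∸ m) m ⟩
      q ^ (s ∸ m) * q ^ m ∎)
    where
    open ≡-Reasoning
    instance
      q≢0 : NonZero q
      q≢0 = >-nonZero (<-trans z<s 1<q)
      qᵐ≢0 : NonZero (q ^ m)
      qᵐ≢0 = m^n≢0 q m
    m≤s : m ≤ s
    m≤s = ≮⇒≥ λ s<m → <⇒≱ (^-monoʳ-< q 1<q s<m) (subst (q ^ m ≤_) eq (m≤n*m (q ^ m) (suc Z)))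

module Counting where
  open import Data.Nat using (_≤_)
  open import Data.Nat.Properties using (≤-trans; 1+n≰n)
  open import Data.Fin using (punchOut)
  open import Data.Fin.Properties using (any?; _≟_; injective⇒≤; punchOut-injective)
  open import Data.Product using (_,_; proj₁; proj₂)
  open import Function.Definitions using (Injective)
  open import Relation.Binary.PropositionalEquality as ≡ using (_≡_; refl)
  open import Relation.Binary.Bundles using (Setoid)
  open import Relation.Nullary using (yes; no)
  open import Relation.Nullary.Negation using (contradiction)

  injective⇒surjective : ∀ {a b} (f : Fin a → Fin b) → Injective _≡_ _≡_ f → b ≤ a →
                         ∀ k → ∃ λ i → f i ≡ k
  injective⇒surjective {a} {suc b} f f-inj b≤a k with any? (λ i → f i ≟ k)
  ... | yes hit = hit
  ... | no miss = contradiction (≤-trans b≤a (injective⇒≤ avoid-inj)) 1+n≰n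
    where
    -- f misses k, so it factors injectively through Fin b
    avoid : Fin a → Fin b
    avoid i = punchOut {i = k} {j = f i} (λ eq → miss (i , ≡.sym eq))
    avoid-inj : Injective _≡_ _≡_ avoid
    avoid-inj {i} {j} eq =
      f-inj (punchOut-injective (λ eq → miss (i , ≡.sym eq)) (λ eq → miss (j , ≡.sym eq)) eq)

  module Families {c ℓ} (S : Setoid c ℓ) where
    open Setoid S renaming (Carrier to A)

    Distinct : ∀ {a} → (Fin a → A) → Set _
    Distinct e = ∀ i j → e i ≈ e j → i ≡ j

    _⊑_ : ∀ {a b} → (Fin a → A) → (Fin b → A) → Set _
    e ⊑ e′ = ∀ i → ∃ λ j → e i ≈ e′ j

    private
      choice-injective : ∀ {a b} {e : Fin a → A} {e′ : Fin b → A} →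
                         Distinct e → (sub : e ⊑ e′) → Injective _≡_ _≡_ (λ i → proj₁ (sub i))
      choice-injective {e = e} {e′} dist sub {i} {j} eq =
        dist i j (trans (proj₂ (sub i)) (sym (≡.subst (λ k → e j ≈ e′ k) (≡.sym eq) (proj₂ (sub j)))))

    distinct-⊑⇒≤ : ∀ {a b} {e : Fin a → A} {e′ : Fin b → A} → Distinct e → e ⊑ e′ → a ≤ b
    distinct-⊑⇒≤ dist sub = injective⇒≤ (choice-injective dist sub)

    distinct-⊑-≥⇒⊒ : ∀ {a b} {e : Fin a → A} {e′ : Fin b → A} →
                     Distinct e → e ⊑ e′ → b ≤ a → e′ ⊑ e
    distinct-⊑-≥⇒⊒ dist sub b≤a k
      with injective⇒surjective _ (choice-injective dist sub) b≤a k
    ... | i , refl = i , sym (proj₂ (sub i))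

    covering-≤⇒distinct : ∀ {a b} {e : Fin a → A} {e′ : Fin b → A} →
                          Distinct e′ → e′ ⊑ e → a ≤ b → Distinct e
    covering-≤⇒distinct {e = e} {e′} dist′ sub a≤b i j eᵢ≈eⱼ
      with injective⇒surjective _ (choice-injective dist′ sub) a≤b i
         | injective⇒surjective _ (choice-injective dist′ sub) a≤b j
    ... | k , refl | k′ , refl =
      ≡.cong (λ t → proj₁ (sub t))
           (dist′ k k′ (trans (proj₂ (sub k)) (trans eᵢ≈eⱼ (sym (proj₂ (sub k′))))))

module FieldFacts {q : ℕ} (F : FiniteField q) where
  open import Data.Nat using (_<_)
  open import Data.Fin using (zero; suc)
  open import Data.Fin.Properties using (injective⇒≤)
  open import Data.Empty using (⊥-elim)
  open import Data.Product using (_,_)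
  open import Relation.Binary.PropositionalEquality
  open FiniteField F
  open CommutativeRing commutativeRing using (semiring; *-comm; *-assoc; *-identityˡ; zeroʳ)
  open import Algebra.Properties.Semiring.Sum semiring
    using (sum; sum-cong-≗; ∑-distrib-+; *-distribˡ-sum; sum-replicate-zero)
  open import Function.Bundles using (Inverse; Injection)
  open import Function.Properties.Inverse using (↔⇒↣)
  open ≡-Reasoning

  -- a field has at least the two distinct elements 0# and 1#
  1<q : 1 < q
  1<q = injective⇒≤ {f = zeroOrOne} zeroOrOne-injective
    where
    zeroOrOne : Fin 2 → Fin q
    zeroOrOne zero    = Inverse.to card 0#
    zeroOrOne (suc _) = Inverse.to card 1#
    0≢1′ : Inverse.to card 0# ≢ Inverse.to card 1#
    0≢1′ eq = 0≢1 (Injection.injective (↔⇒↣ card) eq)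
    zeroOrOne-injective : ∀ {i j} → zeroOrOne i ≡ zeroOrOne j → i ≡ j
    zeroOrOne-injective {zero}        {zero}        _  = refl
    zeroOrOne-injective {zero}        {suc zero}    eq = ⊥-elim (0≢1′ eq)
    zeroOrOne-injective {suc zero}    {zero}        eq = ⊥-elim (0≢1′ (sym eq))
    zeroOrOne-injective {suc zero}    {suc zero}    _  = refl

  cancel-nonzero : ∀ x y → x ≢ 0# → x * y ≡ 0# → y ≡ 0#
  cancel-nonzero x y x≢0 xy≡0 with inverse x x≢0
  ... | x⁻¹ , xx⁻¹≡1 = begin
    y              ≡⟨ *-identityˡ y ⟨
    1# * y         ≡⟨ cong (_* y) (trans (sym xx⁻¹≡1) (*-comm x x⁻¹)) ⟩
    (x⁻¹ * x) * y  ≡⟨ *-assoc x⁻¹ x y ⟩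
    x⁻¹ * (x * y)  ≡⟨ cong (x⁻¹ *_) xy≡0 ⟩
    x⁻¹ * 0#       ≡⟨ zeroʳ x⁻¹ ⟩
    0#             ∎

  -- the finite sums of Defs are the library's sums, so inherit their laws
  sumF≡sum : ∀ k (f : Fin k → Carrier) → sumF k f ≡ sum f
  sumF≡sum zero    f = refl
  sumF≡sum (suc k) f = cong (f zero +_) (sumF≡sum k (λ j → f (suc j)))

  sumF-cong : ∀ k {f g : Fin k → Carrier} → (∀ j → f j ≡ g j) → sumF k f ≡ sumF k g
  sumF-cong k {f} {g} f≗g = trans (sumF≡sum k f) (trans (sum-cong-≗ f≗g) (sym (sumF≡sum k g)))

  sumF-+ : ∀ k (f g : Fin k → Carrier) → sumF k (λ j → f j + g j) ≡ sumF k f + sumF k g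
  sumF-+ k f g = begin
    sumF k (λ j → f j + g j) ≡⟨ sumF≡sum k _ ⟩
    sum (λ j → f j + g j)    ≡⟨ ∑-distrib-+ f g ⟩
    sum f + sum g            ≡⟨ cong₂ _+_ (sumF≡sum k f) (sumF≡sum k g) ⟨
    sumF k f + sumF k g      ∎

  sumF-* : ∀ k c (f : Fin k → Carrier) → sumF k (λ j → c * f j) ≡ c * sumF k f
  sumF-* k c f = begin
    sumF k (λ j → c * f j) ≡⟨ sumF≡sum k _ ⟩
    sum (λ j → c * f j)    ≡⟨ *-distribˡ-sum c f ⟨
    c * sum f              ≡⟨ cong (c *_) (sumF≡sum k f) ⟨
    c * sumF k f           ∎

  sumF-zero : ∀ k → sumF k (λ _ → 0#) ≡ 0#
  sumF-zero k = trans (sumF≡sum k _) (sum-replicate-zero k)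

-- The nonzero elements of a field of order 1 + q′, listed by Fin q′
-- (punch the position of 0# out of F ≅ Fin (1 + q′)).
module NonzeroElements {q′ : ℕ} (F : FiniteField (suc q′)) where
  open import Data.Fin using (punchIn; punchOut)
  open import Data.Fin.Properties using (punchInᵢ≢i; punchIn-punchOut)
  open import Data.Product using (_,_)
  open import Function.Bundles using (Inverse)
  open import Relation.Binary.PropositionalEquality
  open FiniteField F
  open Inverse card using (to; from; strictlyInverseˡ; strictlyInverseʳ)

  nonzero : Fin q′ → Carrier
  nonzero l = from (punchIn (to 0#) l)

  nonzero-≢0 : ∀ l → nonzero l ≢ 0#
  nonzero-≢0 l eq = punchInᵢ≢i (to 0#) l (trans (sym (strictlyInverseˡ _)) (cong to eq))

  nonzero-complete : ∀ a → a ≢ 0# → ∃ λ l → nonzero l ≡ a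
  nonzero-complete a a≢0 = punchOut 0≢a , trans (cong from (punchIn-punchOut 0≢a)) (strictlyInverseʳ a)
    where
    0≢a : to 0# ≢ to a
    0≢a eq = a≢0 (trans (sym (strictlyInverseʳ a)) (trans (cong from (sym eq)) (strictlyInverseʳ 0#)))

-- Linear algebra in F^s for a finite field F of order q, with vectors
-- compared pointwise (_≋_), the only equality available on functions.
module VectorSpace {q : ℕ} (F : FiniteField q) where
  open import Data.Nat using (zero; suc; _≤_; _^_)
  open import Data.Nat.Properties using (≤-refl; ≤-trans; n≤1+n; <⇒≱; ^-monoʳ-<)
  open import Data.Fin using (zero; suc; combine; finToFun; funToFin)
  open import Data.Fin.Properties using (all?; any?; ¬∀⟶∃¬; funToFin-finToFin; finToFun-funToFin)
  open import Data.Product using (Σ; _×_; _,_; proj₁; proj₂)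
  open import Data.Vec.Functional using (_∷_)
  open import Function using (_∘_)
  open import Function.Bundles using (Inverse)
  open import Relation.Binary.PropositionalEquality
  open import Relation.Nullary using (¬_; Dec; yes; no)
  open import Relation.Nullary.Negation using (contradiction)
  open FiniteField F
  open LinAlg F
  open FieldFacts F
  open CommutativeRing commutativeRing
    using (ring; +-group; +-identityˡ; *-comm; *-assoc; *-identityˡ; zeroˡ; distribʳ; -‿inverseʳ)
  open import Algebra.Properties.Ring ring using (-‿distribˡ-*; -‿distribʳ-*; -1*x≈-x)
  open import Algebra.Properties.Group +-group using (inverseˡ-unique; x∙y⁻¹≈ε⇒x≈y)
  open import Data.Vec.Functional.Relation.Binary.Equality.Setoid (setoid Carrier)
    public using (_≋_; ≋-setoid; ≋-sym; ≋-trans; ≋-reflexive)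
  open module Families {s} = Counting.Families (≋-setoid s) public
    using (Distinct; _⊑_; distinct-⊑⇒≤; distinct-⊑-≥⇒⊒; covering-≤⇒distinct)
  open ≡-Reasoning

  _≋?_ : ∀ {s} (u v : Vector s) → Dec (u ≋ v)
  u ≋? v = all? (λ r → u r ≟ v r)

  vectorAt : ∀ {d} → Fin (q ^ d) → Vector d
  vectorAt t r = Inverse.from card (finToFun t r)

  funToFin-cong : ∀ {m n} {f g : Fin m → Fin n} → (∀ r → f r ≡ g r) → funToFin f ≡ funToFin g
  funToFin-cong {zero}  f≗g = refl
  funToFin-cong {suc m} f≗g = cong₂ combine (f≗g zero) (funToFin-cong (f≗g ∘ suc))

  vectorAt-distinct : ∀ {d} → Distinct (vectorAt {d})
  vectorAt-distinct {d} t t′ eq = begin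
    t                                ≡⟨ funToFin-finToFin {d} {q} t ⟨
    funToFin (finToFun {q} {d} t)    ≡⟨ funToFin-cong (λ r → from-injective (eq r)) ⟩
    funToFin (finToFun {q} {d} t′)   ≡⟨ funToFin-finToFin {d} {q} t′ ⟩
    t′                               ∎
    where
    from-injective : ∀ {i j} → Inverse.from card i ≡ Inverse.from card j → i ≡ j
    from-injective {i} {j} e = trans (sym (Inverse.strictlyInverseˡ card i))
                                     (trans (cong (Inverse.to card) e) (Inverse.strictlyInverseˡ card j))

  vectorAt-complete : ∀ {d} (v : Vector d) → ∃ λ t → v ≋ vectorAt t
  vectorAt-complete v = funToFin (Inverse.to card ∘ v) , λ r → sym (begin
    Inverse.from card (finToFun (funToFin (Inverse.to card ∘ v)) r)
      ≡⟨ cong (Inverse.from card) (finToFun-funToFin (Inverse.to card ∘ v) r) ⟩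
    Inverse.from card (Inverse.to card (v r))
      ≡⟨ Inverse.strictlyInverseʳ card (v r) ⟩
    v r ∎)

  lincomb-cong : ∀ {j s} {a a′ : Fin j → Carrier} (B : Fin j → Vector s) →
                 (∀ k → a k ≡ a′ k) → lincomb a B ≋ lincomb a′ B
  lincomb-cong {j} B a≗a′ r = sumF-cong j (λ k → cong (_* B k r) (a≗a′ k))

  lincomb-+ : ∀ {j s} (a b : Fin j → Carrier) (B : Fin j → Vector s) r →
              lincomb (λ k → a k + b k) B r ≡ lincomb a B r + lincomb b B r
  lincomb-+ {j} a b B r =
    trans (sumF-cong j (λ k → distribʳ (B k r) (a k) (b k))) (sumF-+ j _ _)

  lincomb-* : ∀ {j s} c (a : Fin j → Carrier) (B : Fin j → Vector s) r →
              lincomb (λ k → c * a k) B r ≡ c * lincomb a B r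
  lincomb-* {j} c a B r =
    trans (sumF-cong j (λ k → *-assoc c (a k) (B k r))) (sumF-* j c _)

  Independent : ∀ {j s} → (Fin j → Vector s) → Set
  Independent B = ∀ a → lincomb a B ≋ zeroV → ∀ k → a k ≡ 0#

  lincomb-injective : ∀ {j s} {B : Fin j → Vector s} → Independent B →
                      ∀ a a′ → lincomb a B ≋ lincomb a′ B → ∀ k → a k ≡ a′ k
  lincomb-injective {j} {B = B} ind a a′ eq k = x∙y⁻¹≈ε⇒x≈y (a k) (a′ k) (ind difference difference≋0 k)
    where
    difference : Fin j → Carrier
    difference k = a k + - a′ k
    difference≋0 : lincomb difference B ≋ zeroV
    difference≋0 r = begin
      lincomb difference B r                          ≡⟨ lincomb-cong B (λ k → cong (a k +_) (sym (-1*x≈-x (a′ k)))) r ⟩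
      lincomb (λ k → a k + - 1# * a′ k) B r           ≡⟨ lincomb-+ a _ B r ⟩
      lincomb a B r + lincomb (λ k → - 1# * a′ k) B r ≡⟨ cong₂ _+_ (eq r) (lincomb-* (- 1#) a′ B r) ⟩
      lincomb a′ B r + - 1# * lincomb a′ B r          ≡⟨ cong (lincomb a′ B r +_) (-1*x≈-x _) ⟩
      lincomb a′ B r + - lincomb a′ B r               ≡⟨ -‿inverseʳ _ ⟩
      0#                                              ∎

  spanAt : ∀ {j s} → (Fin j → Vector s) → Fin (q ^ j) → Vector s
  spanAt B t = lincomb (vectorAt t) B

  spanAt-complete : ∀ {j s} (B : Fin j → Vector s) a → ∃ λ t → lincomb a B ≋ spanAt B t
  spanAt-complete B a = let t , a≋t = vectorAt-complete a in t , lincomb-cong B a≋t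

  spanAt-distinct : ∀ {j s} {B : Fin j → Vector s} → Independent B → Distinct (spanAt B)
  spanAt-distinct ind t t′ eq = vectorAt-distinct t t′ (lincomb-injective ind _ _ eq)

  extend-independent : ∀ {j s} {B : Fin j → Vector s} (w : Vector s) → Independent B →
                       (∀ a → ¬ (w ≋ lincomb a B)) → Independent (w ∷ B)
  extend-independent {j} {s} {B} w ind w∉span a a·wB≋0 with a zero ≟ 0#
  ... | yes a₀≡0 = λ { zero → a₀≡0 ; (suc k) → ind (a ∘ suc) rest≋0 k }
    where
    rest≋0 : lincomb (a ∘ suc) B ≋ zeroV
    rest≋0 r = begin
      lincomb (a ∘ suc) B r                ≡⟨ +-identityˡ _ ⟨
      0# + lincomb (a ∘ suc) B r           ≡⟨ cong (_+ lincomb (a ∘ suc) B r) (zeroˡ (w r)) ⟨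
      0# * w r + lincomb (a ∘ suc) B r     ≡⟨ cong (λ a₀ → a₀ * w r + lincomb (a ∘ suc) B r) a₀≡0 ⟨
      a zero * w r + lincomb (a ∘ suc) B r ≡⟨ a·wB≋0 r ⟩
      0#                                   ∎
  ... | no a₀≢0 = contradiction w≋combination (w∉span _)
    where
    -- solve a₀ w + L = 0 for w, where L = Σ_k a_{k+1} B_k and b = a₀⁻¹
    b : Carrier
    b = proj₁ (inverse (a zero) a₀≢0)
    L : Vector s
    L = lincomb (a ∘ suc) B
    w≋combination : w ≋ lincomb (λ k → - b * a (suc k)) B
    w≋combination r = begin
      w r                  ≡⟨ *-identityˡ (w r) ⟨
      1# * w r             ≡⟨ cong (_* w r) (trans (sym (proj₂ (inverse (a zero) a₀≢0))) (*-comm (a zero) b)) ⟩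
      (b * a zero) * w r   ≡⟨ *-assoc b (a zero) (w r) ⟩
      b * (a zero * w r)   ≡⟨ cong (b *_) (inverseˡ-unique _ _ (a·wB≋0 r)) ⟩
      b * - L r            ≡⟨ -‿distribʳ-* b (L r) ⟨
      - (b * L r)          ≡⟨ -‿distribˡ-* b (L r) ⟩
      - b * L r            ≡⟨ lincomb-* (- b) (a ∘ suc) B r ⟨
      lincomb (λ k → - b * a (suc k)) B r ∎

  IsSubspace : ∀ {s} → (Vector s → Set) → Set
  IsSubspace {s} W = ∀ {j} (B : Fin j → Vector s) → (∀ k → W (B k)) → ∀ a → W (lincomb a B)

  -- If W has a distinct listing e of q^k elements, then for every j ≤ k it
  -- contains j independent vectors: while j < k the span of the vectors found
  -- has q^j < q^k elements, so it misses some e u, which can be adjoined.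
  independent-family : ∀ {s k} (W : Vector s → Set) (e : Fin (q ^ k) → Vector s) →
    Distinct e → (∀ t → W (e t)) →
    ∀ j → j ≤ k → Σ (Fin j → Vector s) λ B → Independent B × (∀ i → W (B i))
  independent-family W e e-distinct e∈W zero    _   = (λ ()) , (λ _ _ ()) , (λ ())
  independent-family W e e-distinct e∈W (suc j) j<k
    with independent-family W e e-distinct e∈W j (≤-trans (n≤1+n j) j<k)
  ... | B , B-independent , B∈W with all? (λ u → any? (λ t → e u ≋? spanAt B t))
  ... | yes e⊑span = contradiction (distinct-⊑⇒≤ e-distinct e⊑span) (<⇒≱ (^-monoʳ-< q 1<q j<k))
  ... | no  e⋢span with ¬∀⟶∃¬ _ _ (λ u → any? (λ t → e u ≋? spanAt B t)) e⋢span
  ... | u , eᵤ∉span = (e u ∷ B) , extend-independent (e u) B-independent outside , W-extended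
    where
    outside : ∀ a → ¬ (e u ≋ lincomb a B)
    outside a eᵤ≋aB = let t , aB≋t = spanAt-complete B a in eᵤ∉span (t , ≋-trans eᵤ≋aB aB≋t)
    W-extended : ∀ i → W ((e u ∷ B) i)
    W-extended zero    = e∈W u
    W-extended (suc i) = B∈W i

  -- A subspace with exactly q^k elements has a basis of k vectors: k
  -- independent vectors of W span q^k distinct elements of W, hence all of W.
  subspace-basis : ∀ {s k N} (W : Vector s → Set) → IsSubspace W →
    (e : Fin N → Vector s) → N ≡ q ^ k → Distinct e → (∀ t → W (e t)) →
    (∀ v → W v → ∃ λ t → v ≋ e t) →
    Σ (Fin k → Vector s) λ B → Independent B × (∀ i → W (B i)) ×
                              (∀ v → W v → ∃ λ a → v ≋ lincomb a B)
  subspace-basis {k = k} W W-subspace e refl e-distinct e∈W W⊑e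
    with independent-family W e e-distinct e∈W k ≤-refl
  ... | B , B-independent , B∈W = B , B-independent , B∈W , W⊆span
    where
    span⊑e : spanAt B ⊑ e
    span⊑e t = W⊑e _ (W-subspace B B∈W (vectorAt t))
    e⊑span : e ⊑ spanAt B
    e⊑span = distinct-⊑-≥⇒⊒ (spanAt-distinct B-independent) span⊑e ≤-refl
    W⊆span : ∀ v → W v → ∃ λ a → v ≋ lincomb a B
    W⊆span v v∈W = let t , v≋eₜ = W⊑e v v∈W ; t′ , eₜ≋span = e⊑span t in
      vectorAt t′ , ≋-trans v≋eₜ eₜ≋span

-- Every vector is 0 or a nonzero
-- multiple of a column; since there are n·q′ = q^s - 1 such multiples, the
-- representation is unique — the vectors of F^s are listed without repetition
-- by 0 and the multiples  (nonzero l) · G_i.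
module SimplexPoints {q′ s n : ℕ} (F : FiniteField (suc q′))
  (G : Fin s → Fin n → FiniteField.Carrier F)
  (length : n ℕ.* q′ ≡ suc q′ ℕ.^ s ℕ.∸ 1)
  (spanning : ∀ (v : LinAlg.Vector F s) → v ≢ LinAlg.zeroV F →
              ∃ λ i → ∃ λ a → v ≡ LinAlg._·_ F a (LinAlg.column F G i)) where
  open import Data.Nat.Properties using (≤-reflexive; m∸n+n≡m; +-comm; m^n>0)
  open import Data.Fin using (zero; suc; combine; remQuot)
  open import Data.Fin.Properties using (combine-injective; remQuot-combine; combine-remQuot; suc-injective; 0≢1+n)
  open import Data.Product using (_,_; proj₁; proj₂; uncurry)
  open import Function using (_∘_)
  open import Function.Definitions using (Injective)
  open import Relation.Binary.PropositionalEquality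
  open import Relation.Nullary using (¬_; yes; no)
  open FiniteField F
  open LinAlg F
  open VectorSpace F
  open NonzeroElements F
  open CommutativeRing commutativeRing using (zeroˡ; *-identityˡ)

  scaledColumn : Fin n → Fin q′ → Vector s
  scaledColumn i l = nonzero l · column G i

  pointAt : Fin (suc (n ℕ.* q′)) → Vector s
  pointAt zero    = zeroV
  pointAt (suc u) = uncurry scaledColumn (remQuot q′ u)

  pointAt-combine : ∀ i l → pointAt (suc (combine i l)) ≡ scaledColumn i l
  pointAt-combine i l = cong (uncurry scaledColumn) (remQuot-combine i l)

  pointAt-exact : ∀ v → ¬ v ≋ zeroV → ∃ λ t → v ≡ pointAt t
  pointAt-exact v v≉0 with spanning v (λ v≡0 → v≉0 (λ r → cong (λ w → w r) v≡0))
  ... | i , a , v≡a·Gᵢ =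
    suc (combine i l) , trans v≡a·Gᵢ (sym (trans (pointAt-combine i l) (cong (_· column G i) nonzero-l≡a)))
    where
    a≢0 : a ≢ 0#
    a≢0 a≡0 = v≉0 (λ r → trans (cong (λ w → w r) v≡a·Gᵢ) (trans (cong (_* G r i) a≡0) (zeroˡ _)))
    l : Fin q′
    l = proj₁ (nonzero-complete a a≢0)
    nonzero-l≡a : nonzero l ≡ a
    nonzero-l≡a = proj₂ (nonzero-complete a a≢0)

  pointAt-complete : ∀ v → ∃ λ t → v ≋ pointAt t
  pointAt-complete v with v ≋? zeroV
  ... | yes v≋0 = zero , v≋0
  ... | no  v≉0 = let t , v≡pₜ = pointAt-exact v v≉0 in t , ≋-reflexive v≡pₜ

  -- 1 + n q′ = q^s points cover the q^s vectors, hence are all distinct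
  pointAt-distinct : Distinct pointAt
  pointAt-distinct = covering-≤⇒distinct vectorAt-distinct (pointAt-complete ∘ vectorAt)
    (≤-reflexive (trans (cong suc length) (trans (+-comm 1 _) (m∸n+n≡m (m^n>0 (suc q′) s)))))

  ≋-rigid : ∀ {u v} → ¬ u ≋ zeroV → u ≋ v → u ≡ v
  ≋-rigid {u} {v} u≉0 u≋v with pointAt-exact u u≉0 | pointAt-exact v (λ v≋0 → u≉0 (≋-trans u≋v v≋0))
  ... | t , u≡pₜ | t′ , v≡pₜ′ =
    trans u≡pₜ (trans (cong pointAt (pointAt-distinct t t′ pₜ≋pₜ′)) (sym v≡pₜ′))
    where
    pₜ≋pₜ′ : pointAt t ≋ pointAt t′
    pₜ≋pₜ′ = ≋-trans (≋-sym (≋-reflexive u≡pₜ)) (≋-trans u≋v (≋-reflexive v≡pₜ′))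

  column-nonzero : ∀ i → ¬ column G i ≋ zeroV
  column-nonzero i Gᵢ≋0 = 0≢1+n (sym (pointAt-distinct (suc (combine i l)) zero (≋-trans Gᵢ-listed Gᵢ≋0)))
    where
    one : ∃ λ l → nonzero l ≡ 1#
    one = nonzero-complete 1# (λ 1≡0 → 0≢1 (sym 1≡0))
    l : Fin q′
    l = proj₁ one
    Gᵢ-listed : pointAt (suc (combine i l)) ≋ column G i
    Gᵢ-listed r = trans (cong (λ w → w r) (pointAt-combine i l))
                        (trans (cong (_* G r i) (proj₂ one)) (*-identityˡ _))

  pointsOn : ∀ {z} → (Fin z → Fin n) → Fin (suc (z ℕ.* q′)) → Fin (suc (n ℕ.* q′))
  pointsOn ix zero    = zero
  pointsOn {z} ix (suc u) = suc (combine (ix (proj₁ (remQuot {z} q′ u))) (proj₂ (remQuot {z} q′ u)))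

  pointsOn-combine : ∀ {z} (ix : Fin z → Fin n) k l → pointsOn ix (suc (combine k l)) ≡ suc (combine (ix k) l)
  pointsOn-combine ix k l = cong (λ kl → suc (combine (ix (proj₁ kl)) (proj₂ kl))) (remQuot-combine k l)

  pointsOn-injective : ∀ {z} (ix : Fin z → Fin n) → Injective _≡_ _≡_ ix → Injective _≡_ _≡_ (pointsOn ix)
  pointsOn-injective ix ix-inj {zero}  {zero}   _  = refl
  pointsOn-injective {z} ix ix-inj {suc u} {suc u′} eq
    with combine-injective _ _ _ _ (suc-injective eq)
  ... | ixk≡ixk′ , l≡l′ = cong suc (begin
    u                                     ≡⟨ combine-remQuot {z} q′ u ⟨
    uncurry combine (remQuot {z} q′ u)    ≡⟨ cong₂ combine (ix-inj ixk≡ixk′) l≡l′ ⟩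
    uncurry combine (remQuot {z} q′ u′)   ≡⟨ combine-remQuot {z} q′ u′ ⟩
    u′                                        ∎)
    where open ≡-Reasoning

module ZeroPositions {r : ℕ} (K : FiniteField r) where
  open import Data.Nat using (_+_)
  open import Data.Nat.Properties using (+-suc)
  open import Data.Fin using (zero; suc)
  open import Data.Fin.Properties using (suc-injective)
  open import Data.Product using (_,_)
  open import Function using (_∘_)
  open import Relation.Binary.PropositionalEquality using (refl; cong; trans)
  open import Relation.Nullary using (yes; no)
  open import Relation.Nullary.Negation using (contradiction)
  open FiniteField K using (Carrier; _≟_; 0#)
  open Weight K

  zeroCount : ∀ {n} → (Fin n → Carrier) → ℕ
  zeroCount {zero}  c = 0
  zeroCount {suc n} c with c zero ≟ 0#
  ... | yes _ = suc (zeroCount (c ∘ suc))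
  ... | no  _ = zeroCount (c ∘ suc)

  zeroAt : ∀ {n} (c : Fin n → Carrier) → Fin (zeroCount c) → Fin n
  zeroAt {suc n} c with c zero ≟ 0#
  zeroAt {suc n} c | yes _ = λ { zero → zero ; (suc k) → suc (zeroAt (c ∘ suc) k) }
  zeroAt {suc n} c | no  _ = suc ∘ zeroAt (c ∘ suc)

  weight+zeroCount : ∀ {n} (c : Fin n → Carrier) → weight c + zeroCount c ≡ n
  weight+zeroCount {zero}  c = refl
  weight+zeroCount {suc n} c with c zero ≟ 0#
  ... | yes _ = trans (+-suc (weight (c ∘ suc)) _) (cong suc (weight+zeroCount (c ∘ suc)))
  ... | no  _ = cong suc (weight+zeroCount (c ∘ suc))

  zeroAt-zero : ∀ {n} (c : Fin n → Carrier) k → c (zeroAt c k) ≡ 0#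
  zeroAt-zero {suc n} c k with c zero ≟ 0#
  zeroAt-zero {suc n} c zero    | yes c₀≡0 = c₀≡0
  zeroAt-zero {suc n} c (suc k) | yes _    = zeroAt-zero (c ∘ suc) k
  zeroAt-zero {suc n} c k       | no  _    = zeroAt-zero (c ∘ suc) k

  zeroAt-injective : ∀ {n} (c : Fin n → Carrier) {k k′} → zeroAt c k ≡ zeroAt c k′ → k ≡ k′
  zeroAt-injective {suc n} c {k} {k′} with c zero ≟ 0#
  zeroAt-injective {suc n} c {zero}  {zero}   | yes _ = λ _ → refl
  zeroAt-injective {suc n} c {suc k} {suc k′} | yes _ = cong suc ∘ zeroAt-injective (c ∘ suc) ∘ suc-injective
  zeroAt-injective {suc n} c {zero}  {suc _}  | yes _ = λ ()
  zeroAt-injective {suc n} c {suc _} {zero}   | yes _ = λ ()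
  zeroAt-injective {suc n} c {k}     {k′}     | no  _ = zeroAt-injective (c ∘ suc) ∘ suc-injective

  zeroAt-complete : ∀ {n} (c : Fin n → Carrier) i → c i ≡ 0# → ∃ λ k → zeroAt c k ≡ i
  zeroAt-complete {suc n} c i with c zero ≟ 0#
  zeroAt-complete {suc n} c zero    | yes _    = λ _ → zero , refl
  zeroAt-complete {suc n} c zero    | no  c₀≢0 = λ c₀≡0 → contradiction c₀≡0 c₀≢0
  zeroAt-complete {suc n} c (suc i) | yes _    = λ cᵢ≡0 →
    let k , eq = zeroAt-complete (c ∘ suc) i cᵢ≡0 in suc k , cong suc eq
  zeroAt-complete {suc n} c (suc i) | no  _    = λ cᵢ≡0 →
    let k , eq = zeroAt-complete (c ∘ suc) i cᵢ≡0 in k , cong suc eq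

-- The codeword c = x·G of the extension code is the image of the columns
-- under the functional φ(v) = Σ_j x_j ι(v_j) on F^s; its kernel W is an
-- F-subspace, and c_i = 0 exactly when column i lies in W.
module CodewordFunctional {q r s n : ℕ} (F : FiniteField q) (K : FiniteField r)
  (ι : FiniteField.Carrier F → FiniteField.Carrier K) (ι-hom : IsFieldEmbedding F K ι)
  (G : Fin s → Fin n → FiniteField.Carrier F) (c : Fin n → FiniteField.Carrier K)
  (x : Fin s → FiniteField.Carrier K)
  (c≡xG : ∀ i → c i ≡ FiniteField.sumF K s (λ j → FiniteField._*_ K (x j) (ι (G j i)))) where
  open import Data.Fin using (zero; suc)
  open import Data.Product using (_,_)
  open import Function using (_∘_)
  open import Algebra.Morphism.Structures using (module RingMorphisms)
  open import Relation.Binary.PropositionalEquality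
  open FiniteField F
  open LinAlg F
  open VectorSpace F using (_≋_; IsSubspace)
  module K where
    open FiniteField K public
    open CommutativeRing (FiniteField.commutativeRing K) public
      using (zeroˡ; zeroʳ; distribˡ; *-assoc; *-comm; +-identityˡ)
    open FieldFacts K public using (sumF-cong; sumF-+; sumF-*; sumF-zero)
  open RingMorphisms (FiniteField.rawRing F) (FiniteField.rawRing K) using (module IsRingHomomorphism)
  module ι = IsRingHomomorphism ι-hom
  open ≡-Reasoning

  φ : Vector s → K.Carrier
  φ v = K.sumF s (λ j → x j K.* ι (v j))

  φ-column : ∀ i → φ (column G i) ≡ c i
  φ-column i = sym (c≡xG i)

  φ-cong : ∀ {u v} → u ≋ v → φ u ≡ φ v
  φ-cong u≋v = K.sumF-cong s (λ j → cong (λ a → x j K.* ι a) (u≋v j))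

  φ-zero : φ zeroV ≡ K.0#
  φ-zero = trans (K.sumF-cong s (λ j → trans (cong (x j K.*_) ι.0#-homo) (K.zeroʳ (x j)))) (K.sumF-zero s)

  φ-+ : ∀ u v → φ (λ r → u r + v r) ≡ φ u K.+ φ v
  φ-+ u v = trans (K.sumF-cong s (λ j → trans (cong (x j K.*_) (ι.+-homo (u j) (v j))) (K.distribˡ (x j) _ _)))
                  (K.sumF-+ s _ _)

  φ-· : ∀ a v → φ (a · v) ≡ ι a K.* φ v
  φ-· a v = trans (K.sumF-cong s (λ j → trans (cong (x j K.*_) (ι.*-homo a (v j))) (swap (x j) (ι a) (ι (v j)))))
                  (K.sumF-* s (ι a) _)
    where
    swap : ∀ u v w → u K.* (v K.* w) ≡ v K.* (u K.* w)
    swap u v w = trans (sym (K.*-assoc u v w)) (trans (cong (K._* w) (K.*-comm u v)) (K.*-assoc v u w))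

  Kernel : Vector s → Set
  Kernel v = φ v ≡ K.0#

  kernel-subspace : IsSubspace Kernel
  kernel-subspace {zero}  B B∈W a = φ-zero
  kernel-subspace {suc j} B B∈W a = begin
    φ (lincomb a B)                                         ≡⟨ φ-+ (a zero · B zero) (lincomb (a ∘ suc) (B ∘ suc)) ⟩
    φ (a zero · B zero) K.+ φ (lincomb (a ∘ suc) (B ∘ suc)) ≡⟨ cong₂ K._+_ head≡0 tail≡0 ⟩
    K.0# K.+ K.0#                                           ≡⟨ K.+-identityˡ K.0# ⟩
    K.0#                                                    ∎
    where
    head≡0 : φ (a zero · B zero) ≡ K.0#
    head≡0 = trans (φ-· (a zero) (B zero)) (trans (cong (ι (a zero) K.*_) (B∈W zero)) (K.zeroʳ _))
    tail≡0 : φ (lincomb (a ∘ suc) (B ∘ suc)) ≡ K.0#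
    tail≡0 = kernel-subspace (B ∘ suc) (B∈W ∘ suc) (a ∘ suc)

  ι-nonzero : ∀ a → a ≢ 0# → ι a ≢ K.0#
  ι-nonzero a a≢0 ιa≡0 with inverse a a≢0
  ... | b , ab≡1 = K.0≢1 (begin
    K.0#              ≡⟨ K.zeroˡ (ι b) ⟨
    K.0# K.* ι b      ≡⟨ cong (K._* ι b) ιa≡0 ⟨
    ι a K.* ι b       ≡⟨ ι.*-homo a b ⟨
    ι (a * b)         ≡⟨ cong ι ab≡1 ⟩
    ι 1#              ≡⟨ ι.1#-homo ⟩
    K.1#              ∎)

  φ-scaled-column : ∀ a i → φ (a · column G i) ≡ ι a K.* c i
  φ-scaled-column a i = trans (φ-· a (column G i)) (cong (ι a K.*_) (φ-column i))

  scaled-column-in-kernel : ∀ a i → c i ≡ K.0# → Kernel (a · column G i)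
  scaled-column-in-kernel a i cᵢ≡0 = trans (φ-scaled-column a i) (trans (cong (ι a K.*_) cᵢ≡0) (K.zeroʳ _))

  kernel-scaled-column : ∀ a i → a ≢ 0# → Kernel (a · column G i) → c i ≡ K.0#
  kernel-scaled-column a i a≢0 in-W =
    FieldFacts.cancel-nonzero K (ι a) (c i) (ι-nonzero a a≢0) (trans (sym (φ-scaled-column a i)) in-W)

-- For q = 1 + q′, the kernel W of φ consists of 0 and the multiples
-- (nonzero l)·G_i with c_i = 0, listed without repetition through the zero
-- positions of c; so W has exactly 1 + q′·(number of zeros of c) elements.
module KernelPoints {q′ r s n : ℕ} (F : FiniteField (suc q′)) (K : FiniteField r)
  (ι : FiniteField.Carrier F → FiniteField.Carrier K) (ι-hom : IsFieldEmbedding F K ι)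
  (G : Fin s → Fin n → FiniteField.Carrier F)
  (length : n ℕ.* q′ ≡ suc q′ ℕ.^ s ℕ.∸ 1)
  (spanning : ∀ (v : LinAlg.Vector F s) → v ≢ LinAlg.zeroV F →
              ∃ λ i → ∃ λ a → v ≡ LinAlg._·_ F a (LinAlg.column F G i))
  (c : Fin n → FiniteField.Carrier K) (x : Fin s → FiniteField.Carrier K)
  (c≡xG : ∀ i → c i ≡ FiniteField.sumF K s (λ j → FiniteField._*_ K (x j) (ι (G j i)))) where
  open import Data.Fin using (zero; suc; combine; remQuot)
  open import Data.Fin.Properties using (combine-surjective)
  open import Data.Product using (_×_; _,_; proj₁; proj₂)
  open import Function using (_∘_)
  open import Relation.Binary.PropositionalEquality
  open import Function.Bundles using (_⇔_; mk⇔)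
  open LinAlg F using (Vector; column; lincomb; InSpan; LinearlyIndependent)
  open VectorSpace F using (_≋_; ≋-trans; ≋-reflexive; Distinct; subspace-basis)
  open NonzeroElements F
  open SimplexPoints F G length spanning
  open CodewordFunctional F K ι ι-hom G c x c≡xG
  open ZeroPositions K

  kernelPointAt : Fin (suc (zeroCount c ℕ.* q′)) → Vector s
  kernelPointAt = pointAt ∘ pointsOn (zeroAt c)

  kernelPoint-distinct : Distinct kernelPointAt
  kernelPoint-distinct t t′ eq = pointsOn-injective (zeroAt c) (zeroAt-injective c) (pointAt-distinct _ _ eq)

  kernelPoint-∈ : ∀ t → Kernel (kernelPointAt t)
  kernelPoint-∈ zero    = φ-zero
  kernelPoint-∈ (suc u) = trans (cong φ (pointAt-combine (zeroAt c k) l))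
                                (scaled-column-in-kernel (nonzero l) (zeroAt c k) (zeroAt-zero c k))
    where
    k : Fin (zeroCount c)
    k = proj₁ (remQuot {zeroCount c} q′ u)
    l : Fin q′
    l = proj₂ (remQuot {zeroCount c} q′ u)

  kernel-point-listed : ∀ t → Kernel (pointAt t) → ∃ λ t′ → pointsOn (zeroAt c) t′ ≡ t
  kernel-point-listed zero    _    = zero , refl
  kernel-point-listed (suc u) p∈W with combine-surjective {n} {q′} u
  ... | i , l , refl =
    suc (combine k l) , trans (pointsOn-combine (zeroAt c) k l) (cong (λ j → suc (combine j l)) zeroAtₖ≡i)
    where
    cᵢ≡0 : c i ≡ FiniteField.0# K
    cᵢ≡0 = kernel-scaled-column (nonzero l) i (nonzero-≢0 l) (trans (cong φ (sym (pointAt-combine i l))) p∈W)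
    k : Fin (zeroCount c)
    k = proj₁ (zeroAt-complete c i cᵢ≡0)
    zeroAtₖ≡i : zeroAt c k ≡ i
    zeroAtₖ≡i = proj₂ (zeroAt-complete c i cᵢ≡0)

  kernelPoint-complete : ∀ v → Kernel v → ∃ λ t → v ≋ kernelPointAt t
  kernelPoint-complete v v∈W =
    let t , v≋pₜ = pointAt-complete v
        t′ , listed = kernel-point-listed t (trans (sym (φ-cong v≋pₜ)) v∈W)
    in t′ , ≋-trans v≋pₜ (≋-reflexive (cong pointAt (sym listed)))

  zeros-form-subspace : ∀ {k} → suc (zeroCount c ℕ.* q′) ≡ suc q′ ℕ.^ k →
    ∃ λ (B : Fin k → Vector s) →
      LinearlyIndependent B × (∀ i → (c i ≡ FiniteField.0# K) ⇔ InSpan (column G i) B)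
  zeros-form-subspace size with subspace-basis Kernel kernel-subspace kernelPointAt size
                                  kernelPoint-distinct kernelPoint-∈ kernelPoint-complete
  ... | B , B-independent , B∈W , W⊆span =
    B , (λ a aB≡0 → B-independent a (λ r → cong (λ w → w r) aB≡0)) ,
    λ i → mk⇔ (zero⇒inSpan i) (inSpan⇒zero i)
    where
    zero⇒inSpan : ∀ i → c i ≡ FiniteField.0# K → InSpan (column G i) B
    zero⇒inSpan i cᵢ≡0 = let a , Gᵢ≋aB = W⊆span (column G i) (trans (φ-column i) cᵢ≡0) in
      a , ≋-rigid (column-nonzero i) Gᵢ≋aB
    inSpan⇒zero : ∀ i → InSpan (column G i) B → c i ≡ FiniteField.0# K
    inSpan⇒zero i (a , Gᵢ≡aB) = begin
      c i              ≡⟨ φ-column i ⟨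
      φ (column G i)   ≡⟨ cong φ Gᵢ≡aB ⟩
      φ (lincomb a B)  ≡⟨ kernel-subspace B B∈W a ⟩
      FiniteField.0# K ∎
      where open ≡-Reasoning

open import Data.Nat using (_+_; _*_; _∸_; _^_; _≤_)
open import Data.Fin.Properties using (¬Fin0)
open import Data.Product using (_×_; _,_; proj₁; proj₂)
open import Data.Empty using (⊥-elim)
open import Function.Bundles using (_⇔_; Inverse)
open WeightArithmetic using (zeroCount-equation; power-quotient)

-- The field F is nonempty, so q = 1 + q′.
mainTheorem3 :
    ∀ {q m s n : ℕ} (F : FiniteField q) (K : FiniteField (q ^ m))
      (ι : FiniteField.Carrier F → FiniteField.Carrier K) →
    IsFieldEmbedding F K ι →
    1 ≤ s → 1 ≤ m →
    (G : Fin s → Fin n → FiniteField.Carrier F) →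
    n * (q ∸ 1) ≡ q ^ s ∸ 1 →
    LinAlg.IsSimplexGenerator F G →
    (c : Fin n → FiniteField.Carrier K) →
    (∃ λ (x : Fin s → FiniteField.Carrier K) →
       ∀ i → c i ≡ FiniteField.sumF K s (λ j → FiniteField._*_ K (x j) (ι (G j i)))) →
    Weight.weight K c * (q ∸ 1) * q ^ m ≡ q ^ (s + m) ∸ q ^ s →
    (m ≤ s) ×
    (∃ λ (B : Fin (s ∸ m) → LinAlg.Vector F s) →
       LinAlg.LinearlyIndependent F B ×
       (∀ i → (c i ≡ FiniteField.0# K) ⇔ LinAlg.InSpan F (LinAlg.column F G i) B))
mainTheorem3 {zero} F _ _ _ _ _ _ _ _ _ _ _ =
  ⊥-elim (¬Fin0 (Inverse.to (FiniteField.card F) (FiniteField.0# F)))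
mainTheorem3 {suc q′} {m} {s} {n} F K ι ι-hom _ _ G length (_ , spanning , _) c (x , c≡xG) weight-eq =
  m≤s , zeros-form-subspace kernel-size
  where
  open KernelPoints F K ι ι-hom G length spanning c x c≡xG using (zeros-form-subspace)
  open ZeroPositions K using (zeroCount; weight+zeroCount)
  counts : m ≤ s × suc (zeroCount c * q′) ≡ suc q′ ^ (s ∸ m)
  counts = power-quotient (suc q′) (zeroCount c * q′) s m (FieldFacts.1<q F)
             (zeroCount-equation q′ s m n (Weight.weight K c) (zeroCount c) length weight-eq (weight+zeroCount c))
  m≤s : m ≤ s
  m≤s = proj₁ counts
  kernel-size : suc (zeroCount c * q′) ≡ suc q′ ^ (s ∸ m)
  kernel-size = proj₂ counts
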